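{- Let $x,y$ be strings and let $I\times J$ be a box (with $I\subseteq\{1,\dots,|x|\}$, $J\subseteq\{1,\dots,|y|\}$ nonempty intervals) that is $(x,y)$-compatible. Then the restriction of the canonical alignment $\mathrm{canon}(x,y)$ to $I\times J$ is equal to the canonical alignment of $\mathbf{Grid}_{I\times J}(x,y)$.
   Context: The grid graph $\mathbf{Grid}(x,y)$ has vertex set $\{0,\dots,|x|\}\times\{0,\dots,|y|\}$ and edges: horizontal $(i,j)\to(i+1,j)$, vertical $(i,j)\to(i,j+1)$, diagonal $(i,j)\to(i+1,j+1)$. Horizontal and vertical edges cost $1$; a diagonal edge $(i-1,j-1)\to(i,j)$ costs $0$ if $x_i=y_j$ and $1$ otherwise. For nonempty intervals $I,J$, $\mathbf{Grid}_{I\times J}(x,y)$ is the subgraph induced on $(I\cup\{\min I-1\})\times(J\cup\{\min J-1\})$ (with the same costs); a spanning path of it is a directed path from $(\min I-1,\min J-1)$ to $(\max I,\max J)$. The canonical alignment of $\mathbf{Grid}_{I\times J}(x,y)$ is the minimum-cost spanning path whose sequence of edge types is lexicographically maximum under the order vertical $>$ diagonal $>$ horizontal; $\mathrm{canon}(x,y)$ is the canonical alignment of the whole grid $\mathbf{Grid}(x,y)$. The box $I\times J$ is $(x,y)$-compatible if $\mathrm{canon}(x,y)$ passes through $(\min I-1,\min J-1)$ and $(\max I,\max J)$; the restriction of $\mathrm{canon}(x,y)$ to $I\times J$ is then the portion of it joining these two points. -}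

module Defs where

open import Data.Nat using (ℕ; zero; suc; _+_; _≤_; _<_)
open import Data.List using (List; []; _∷_; length)
open import Data.Maybe using (Maybe; just; nothing)
open import Data.Product using (_×_; _,_)
open import Relation.Binary.PropositionalEquality using (_≡_)
open import Relation.Binary.Definitions using (DecidableEquality)
open import Relation.Nullary using (yes; no)
open import Data.Sum using (_⊎_)

data Step : Set where
  H V D : Step

rank : Step → ℕ
rank H = 0
rank D = 1
rank V = 2

-- A path in the grid is given by its start vertex and its sequence of edge types.
Vertex : Set
Vertex = ℕ × ℕ

move : Vertex → Step → Vertex
move (i , j) H = (suc i , j)
move (i , j) V = (i , suc j)
move (i , j) D = (suc i , suc j)

walk : Vertex → List Step → Vertex
walk v []       = v
walk v (s ∷ ss) = walk (move v s) ss

-- 0-based lookup; at xs k is the (k+1)-st character x_{k+1}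
at : {A : Set} → List A → ℕ → Maybe A
at []       _       = nothing
at (a ∷ as) zero    = just a
at (a ∷ as) (suc k) = at as k

module _ {A : Set} (_≟_ : DecidableEquality A) (x y : List A) where

  -- cost of the diagonal edge (i,j) → (i+1,j+1), i.e. comparing x_{i+1} with y_{j+1}
  diagCost : ℕ → ℕ → ℕ
  diagCost i j with at x i | at y j
  ... | just a | just b with a ≟ b
  ...   | yes _ = 0
  ...   | no  _ = 1
  diagCost i j | _ | _ = 1

  stepCost : Vertex → Step → ℕ
  stepCost _       H = 1
  stepCost _       V = 1
  stepCost (i , j) D = diagCost i j

  pathCost : Vertex → List Step → ℕ
  pathCost v []       = 0
  pathCost v (s ∷ ss) = stepCost v s + pathCost (move v s) ss

data _≼_ : List Step → List Step → Set where
  []≼  : ∀ {q} → [] ≼ q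
  <≼   : ∀ {s t p q} → rank s < rank t → (s ∷ p) ≼ (t ∷ q)
  ∷≼   : ∀ {s p q} → p ≼ q → (s ∷ p) ≼ (s ∷ q)

module _ {A : Set} (_≟_ : DecidableEquality A) (x y : List A) where

  -- spanning path of the grid sub-graph with corners s (bottom-left) and t (top-right):
  -- a directed path from s to t (monotone, hence it stays inside the box)
  Spanning : Vertex → Vertex → List Step → Set
  Spanning s t p = walk s p ≡ t

  IsCanonical : Vertex → Vertex → List Step → Set
  IsCanonical s t p =
    Spanning s t p ×
    (∀ q → Spanning s t q →
       (pathCost _≟_ x y s p ≤ pathCost _≟_ x y s q) ×
       (pathCost _≟_ x y s q ≡ pathCost _≟_ x y s p → q ≼ p))

  IsCanon : List Step → Set
  IsCanon = IsCanonical (0 , 0) (length x , length y)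

-- An alignment through u and v splits into three independent pieces, so its cost is a sum and
-- lexicographic comparison between splicings of the same outer pieces only sees the middle
-- piece.  Hence if some other u→v path beat the middle piece of canon(x,y) in cost, or tied in
-- cost and were lexicographically larger, splicing it in would beat canon(x,y) itself.
module Submission where

open import Defs
open import Data.Nat using (ℕ; _≤_; _<_; _+_)
open import Data.Nat.Properties
open import Data.List using (List; length; _++_; []; _∷_)
open import Data.Product using (_,_; proj₁; proj₂)
open import Data.Empty using (⊥-elim)
open import Relation.Nullary using (¬_)
open import Relation.Binary.PropositionalEquality
open import Relation.Binary.Definitions using (DecidableEquality)

walk-++ : ∀ v p q → walk v (p ++ q) ≡ walk (walk v p) q
walk-++ v []      q = refl
walk-++ v (s ∷ p) q = walk-++ (move v s) p q

walk-splice : ∀ {s u v} p₁ r p₃ → walk s p₁ ≡ u → walk u r ≡ v →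
              walk s (p₁ ++ (r ++ p₃)) ≡ walk v p₃
walk-splice {s} {u} {v} p₁ r p₃ w₁ w₂ = begin
  walk s (p₁ ++ (r ++ p₃))  ≡⟨ walk-++ s p₁ (r ++ p₃) ⟩
  walk (walk s p₁) (r ++ p₃) ≡⟨ cong (λ w → walk w (r ++ p₃)) w₁ ⟩
  walk u (r ++ p₃)          ≡⟨ walk-++ u r p₃ ⟩
  walk (walk u r) p₃        ≡⟨ cong (λ w → walk w p₃) w₂ ⟩
  walk v p₃                 ∎
  where open ≡-Reasoning

height : Vertex → ℕ
height (i , j) = i + j

height-move : ∀ v s → height v < height (move v s)
height-move (i , j) H = ≤-refl
height-move (i , j) V = ≤-reflexive (sym (+-suc i j))
height-move (i , j) D = <-trans (n<1+n (i + j)) (≤-reflexive (cong ℕ.suc (sym (+-suc i j))))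

height-walk : ∀ v p → height v ≤ height (walk v p)
height-walk v []      = ≤-refl
height-walk v (s ∷ p) = ≤-trans (<⇒≤ (height-move v s)) (height-walk (move v s) p)

walk-∷-≢ : ∀ v s p → ¬ walk v (s ∷ p) ≡ v
walk-∷-≢ v s p eq = <⇒≱ (height-move v s)
  (≤-trans (height-walk (move v s) p) (≤-reflexive (cong height eq)))

≼-++ˡ-cancel : ∀ p q r → (p ++ q) ≼ (p ++ r) → q ≼ r
≼-++ˡ-cancel []      q r h        = h
≼-++ˡ-cancel (s ∷ p) q r (<≼ s<s) = ⊥-elim (<-irrefl refl s<s)
≼-++ˡ-cancel (s ∷ p) q r (∷≼ h)   = ≼-++ˡ-cancel p q r h

-- Without the common endpoint this fails: [ H ] ++ [ V ] ≼ [] ++ [ V ] but not [ H ] ≼ [].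
≼-++ʳ-cancel : ∀ v p q r → walk v p ≡ walk v q → (p ++ r) ≼ (q ++ r) → p ≼ q
≼-++ʳ-cancel v []      q       r e h        = []≼
≼-++ʳ-cancel v (s ∷ p) []      r e h        = ⊥-elim (walk-∷-≢ v s p e)
≼-++ʳ-cancel v (s ∷ p) (t ∷ q) r e (<≼ s<t) = <≼ s<t
≼-++ʳ-cancel v (s ∷ p) (s ∷ q) r e (∷≼ h)   = ∷≼ (≼-++ʳ-cancel (move v s) p q r e h)

module _ {A : Set} (_≟_ : DecidableEquality A) (x y : List A) where

  private
    cost : Vertex → List Step → ℕ
    cost = pathCost _≟_ x y

  pathCost-++ : ∀ v p q → cost v (p ++ q) ≡ cost v p + cost (walk v p) q
  pathCost-++ v []      q = refl
  pathCost-++ v (s ∷ p) q = begin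
    stepCost _≟_ x y v s + cost (move v s) (p ++ q)
      ≡⟨ cong (stepCost _≟_ x y v s +_) (pathCost-++ (move v s) p q) ⟩
    stepCost _≟_ x y v s + (cost (move v s) p + cost (walk (move v s) p) q)
      ≡⟨ sym (+-assoc (stepCost _≟_ x y v s) _ _) ⟩
    stepCost _≟_ x y v s + cost (move v s) p + cost (walk (move v s) p) q ∎
    where open ≡-Reasoning

  pathCost-splice : ∀ {s u v} p₁ r p₃ → walk s p₁ ≡ u → walk u r ≡ v →
                    cost s (p₁ ++ (r ++ p₃)) ≡ cost s p₁ + (cost u r + cost v p₃)
  pathCost-splice {s} {u} {v} p₁ r p₃ w₁ w₂ = begin
    cost s (p₁ ++ (r ++ p₃))                    ≡⟨ pathCost-++ s p₁ (r ++ p₃) ⟩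
    cost s p₁ + cost (walk s p₁) (r ++ p₃)      ≡⟨ cong (λ w → cost s p₁ + cost w (r ++ p₃)) w₁ ⟩
    cost s p₁ + cost u (r ++ p₃)                ≡⟨ cong (cost s p₁ +_) (pathCost-++ u r p₃) ⟩
    cost s p₁ + (cost u r + cost (walk u r) p₃) ≡⟨ cong (λ w → cost s p₁ + (cost u r + cost w p₃)) w₂ ⟩
    cost s p₁ + (cost u r + cost v p₃)          ∎
    where open ≡-Reasoning

  IsCanonical-infix : ∀ {s t u v} p₁ p₂ p₃ →
    IsCanonical _≟_ x y s t (p₁ ++ (p₂ ++ p₃)) →
    walk s p₁ ≡ u → walk u p₂ ≡ v →
    IsCanonical _≟_ x y u v p₂
  IsCanonical-infix {s} {t} {u} {v} p₁ p₂ p₃ (spans , optimal) w₁ w₂ =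
    w₂ , λ q q-spans → cost-min q q-spans , lex-max q q-spans
    where
    spliced-spans : ∀ q → walk u q ≡ v → walk s (p₁ ++ (q ++ p₃)) ≡ t
    spliced-spans q wq = trans (walk-splice p₁ q p₃ w₁ wq)
                               (trans (sym (walk-splice p₁ p₂ p₃ w₁ w₂)) spans)

    cost-min : ∀ q → walk u q ≡ v → cost u p₂ ≤ cost u q
    cost-min q wq = +-cancelʳ-≤ (cost v p₃) _ _ (+-cancelˡ-≤ (cost s p₁) _ _
      (subst₂ _≤_ (pathCost-splice p₁ p₂ p₃ w₁ w₂) (pathCost-splice p₁ q p₃ w₁ wq)
        (proj₁ (optimal (p₁ ++ (q ++ p₃)) (spliced-spans q wq)))))

    lex-max : ∀ q → walk u q ≡ v → cost u q ≡ cost u p₂ → q ≼ p₂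
    lex-max q wq same-cost = ≼-++ʳ-cancel u q p₂ p₃ (trans wq (sym w₂))
      (≼-++ˡ-cancel p₁ _ _ (proj₂ (optimal (p₁ ++ (q ++ p₃)) (spliced-spans q wq)) same-total))
      where
      same-total : cost s (p₁ ++ (q ++ p₃)) ≡ cost s (p₁ ++ (p₂ ++ p₃))
      same-total = begin
        cost s (p₁ ++ (q ++ p₃))           ≡⟨ pathCost-splice p₁ q p₃ w₁ wq ⟩
        cost s p₁ + (cost u q + cost v p₃)  ≡⟨ cong (λ c → cost s p₁ + (c + cost v p₃)) same-cost ⟩
        cost s p₁ + (cost u p₂ + cost v p₃) ≡⟨ sym (pathCost-splice p₁ p₂ p₃ w₁ w₂) ⟩
        cost s (p₁ ++ (p₂ ++ p₃))          ∎
        where open ≡-Reasoning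

proposition5 : {A : Set} (_≟_ : DecidableEquality A) (x y : List A)
    (i₀ i₁ j₀ j₁ : ℕ) → i₀ < i₁ → i₁ ≤ length x → j₀ < j₁ → j₁ ≤ length y →
    (p : List Step) → IsCanon _≟_ x y p →
    (p₁ p₂ p₃ : List Step) → p ≡ p₁ ++ (p₂ ++ p₃) →
    walk (0 , 0) p₁ ≡ (i₀ , j₀) → walk (i₀ , j₀) p₂ ≡ (i₁ , j₁) →
    IsCanonical _≟_ x y (i₀ , j₀) (i₁ , j₁) p₂
proposition5 _≟_ x y _ _ _ _ _ _ _ _ p canon p₁ p₂ p₃ refl w₁ w₂ =
  IsCanonical-infix _≟_ x y p₁ p₂ p₃ canon w₁ w₂
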